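{- Let $(W,\prec)$ be any $\mathsf{MN}$-frame and let $p$ be a propositional variable. Then: (1) $\Box p \to \Box\Box p$ is valid in $(W,\prec)$ if and only if $(W,\prec)$ is transitive; (2) $\neg\Box\bot$ is valid in $(W,\prec)$ if and only if $(W,\prec)$ is an $\mathsf{MNP}$-frame; (3) $\neg(\Box p \land \Box\neg p)$ is valid in $(W,\prec)$ if and only if $(W,\prec)$ is an $\mathsf{MND}$-frame.
   Context: The modal language has countably many propositional variables, the constant $\bot$, the connective $\to$ and the operator $\Box$; $\top,\neg,\land,\lor,\Diamond$ are the usual abbreviations. An $\mathsf{MN}$-frame is a pair $(W,\prec)$ where $W$ is a non-empty set and $\prec$ is a relation between elements of $W$ and non-empty subsets of $W$ satisfying monotonicity: if $x\prec V$ and $V\subseteq U\subseteq W$ then $x\prec U$. A satisfaction relation $\Vdash$ on $(W,\prec)$ is a relation between $W$ and modal formulas satisfying the usual clauses for $\bot$ and $\to$ (so $x\nVdash\bot$, and $x\Vdash A\to B$ iff $x\nVdash A$ or $x\Vdash B$) and: $x\Vdash\Box A$ iff for every $V\subseteq W$ with $x\prec V$ there is $y\in V$ with $y\Vdash A$. A formula is valid in $(W,\prec)$ if $x\Vdash A$ for every satisfaction relation $\Vdash$ on the frame and every $x\in W$. The frame $(W,\prec)$ is transitive if whenever $x\prec V$ and for each $y\in V$ there is $U_y\subseteq W$ with $y\prec U_y$, then $x\prec\bigcup_{y\in V}U_y$. It is an $\mathsf{MNP}$-frame if for every $x\in W$ there is $V\subseteq W$ with $x\prec V$. It is an $\mathsf{MND}$-frame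 if for every $x\in W$ and every $V\subseteq W$, $x\prec V$ or $x\prec (W\setminus V)$. -}

module Defs where

open import Level using (0ℓ)
open import Data.Nat using (ℕ)
open import Data.Empty using (⊥)
open import Data.Product using (Σ; ∃; _×_; _,_; proj₁)
open import Data.Sum using (_⊎_)
open import Relation.Nullary using (¬_)
open import Relation.Unary using (Pred; _⊆_)
open import Function.Bundles using (_⇔_)

data Fm : Set where
  var  : ℕ → Fm
  bot  : Fm
  _⇒_  : Fm → Fm → Fm
  box  : Fm → Fm

infixr 5 _⇒_

neg : Fm → Fm
neg A = A ⇒ bot

top : Fm
top = neg bot

_∧_ : Fm → Fm → Fm
A ∧ B = neg (A ⇒ neg B)

_∨_ : Fm → Fm → Fm
A ∨ B = neg A ⇒ B

dia : Fm → Fm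
dia A = neg (box (neg A))

Subset : Set → Set₁
Subset W = Pred W 0ℓ

NonEmpty : {W : Set} → Subset W → Set
NonEmpty {W} V = Σ W V

Complement : {W : Set} → Subset W → Subset W
Complement V x = ¬ V x

record MNFrame : Set₂ where
  field
    W         : Set
    inhabited : W
    _≺_       : W → Subset W → Set
    ≺-nonempty : ∀ {x V} → x ≺ V → NonEmpty V
    ≺-mono    : ∀ {x V U} → x ≺ V → V ⊆ U → x ≺ U

module _ (F : MNFrame) where
  open MNFrame F

  record SatRel : Set₁ where
    field
      _⊩_    : W → Fm → Set
      ⊩-bot  : ∀ x → ¬ (x ⊩ bot)
      ⊩-imp  : ∀ x A B → (x ⊩ (A ⇒ B)) ⇔ ((¬ (x ⊩ A)) ⊎ (x ⊩ B))
      ⊩-box  : ∀ x A → (x ⊩ box A) ⇔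
                 (∀ (V : Subset W) → x ≺ V → Σ W (λ y → V y × (y ⊩ A)))

  Valid : Fm → Set₁
  Valid A = (S : SatRel) → (x : W) → SatRel._⊩_ S x A

  Transitive : Set₁
  Transitive =
    ∀ (x : W) (V : Subset W) → x ≺ V →
    (h : ∀ y → V y → Σ (Subset W) (λ U → y ≺ U)) →
    x ≺ (λ z → Σ W (λ y → Σ (V y) (λ vy → proj₁ (h y vy) z)))

  IsMNP : Set₁
  IsMNP = ∀ (x : W) → Σ (Subset W) (λ V → x ≺ V)

  IsMND : Set₁
  IsMND = ∀ (x : W) (V : Subset W) → (x ≺ V) ⊎ (x ≺ Complement V)

-- Classically, x ⊩ □A holds iff not x ≺ ∁‖A‖, where ‖A‖ is the truth set of A: by
-- monotonicity ∁‖A‖ is the one neighbourhood that must be checked.  Hence ¬□⊥ at x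
-- says x ≺ ∁∅ = W, ¬(□A ∧ □¬A) says x ≺ ‖A‖ or x ≺ ∁‖A‖, and □A → □□A follows from
-- transitivity applied to the constant family y ↦ ∁‖A‖.  Conversely, making p true
-- exactly on V, resp. on the complement of the union ⋃ U_y in the definition of
-- transitivity, turns validity back into the frame condition.
module Submission where

open import Defs
open import Level using (0ℓ)
open import Data.Nat using (ℕ)
open import Data.Empty using (⊥; ⊥-elim)
open import Data.Product using (Σ; _×_; _,_; proj₁; proj₂)
open import Data.Sum using (_⊎_; inj₁; inj₂; [_,_]′)
open import Function using (_∘_; id)
open import Function.Bundles using (_⇔_; mk⇔; Equivalence)
import Function.Properties.Equivalence as ⇔
open import Relation.Nullary using (¬_)
open import Relation.Nullary.Decidable using (True; toWitness; fromWitness; toSum)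
open import Relation.Nullary.Negation using (contraposition)
open import Relation.Unary using (∁; _≬_)
open import Axiom.ExcludedMiddle using (ExcludedMiddle)
open import Axiom.DoubleNegationElimination using (DoubleNegationElimination; em⇒dne)

open Equivalence using (to; from)

module Classical (em : ExcludedMiddle 0ℓ) where

  dne : DoubleNegationElimination 0ℓ
  dne = em⇒dne em

  ¬⊎⇔→ : {P Q : Set} → (¬ P ⊎ Q) ⇔ (P → Q)
  ¬⊎⇔→ = mk⇔ (λ h p → [ (λ ¬p → ⊥-elim (¬p p)) , id ]′ h)
              (λ f → [ inj₂ ∘ f , inj₁ ]′ (toSum em))

  ¬[¬×¬]⇔⊎ : {P Q : Set} → (¬ (¬ P × ¬ Q)) ⇔ (P ⊎ Q)
  ¬[¬×¬]⇔⊎ = mk⇔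
    (λ n → [ inj₁ , (λ ¬p → inj₂ (dne λ ¬q → n (¬p , ¬q))) ]′ (toSum em))
    (λ { (inj₁ p) (¬p , _) → ¬p p ; (inj₂ q) (_ , ¬q) → ¬q q })

module Neighbourhoods (em : ExcludedMiddle 0ℓ) (F : MNFrame) where
  open MNFrame F
  open Classical em

  ≺-∁∁ : ∀ {x U} → x ≺ ∁ (∁ U) → x ≺ U
  ≺-∁∁ c = ≺-mono c dne

  meetsAll⇔¬≺∁ : ∀ {x} (U : Subset W) → (∀ (V : Subset W) → x ≺ V → V ≬ U) ⇔ (¬ x ≺ ∁ U)
  meetsAll⇔¬≺∁ {x} U = mk⇔ {A = ∀ (V : Subset W) → x ≺ V → V ≬ U}
    (λ meets c → let (_ , ¬u , u) = meets (∁ U) c in ¬u u)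
    (λ n V xV → dne λ disjoint → n (≺-mono xV λ v u → disjoint (_ , v , u)))

  transitive-const : Transitive F → ∀ {x V U} → x ≺ V → (∀ {y} → V y → y ≺ U) → x ≺ U
  transitive-const tr {x} {V} {U} xV yU =
    ≺-mono (tr x V xV λ _ v → U , yU v) λ (_ , _ , u) → u

  module Truth (S : SatRel F) where
    open SatRel S public

    ‖_‖ : Fm → Subset W
    ‖ A ‖ y = y ⊩ A

    ⊩⇒⇔→ : ∀ {x A B} → x ⊩ (A ⇒ B) ⇔ (x ⊩ A → x ⊩ B)
    ⊩⇒⇔→ {x} {A} {B} = ⇔.trans (⊩-imp x A B) ¬⊎⇔→

    ⊩neg⇔¬ : ∀ {x A} → x ⊩ neg A ⇔ (¬ x ⊩ A)
    ⊩neg⇔¬ {x} = ⇔.trans ⊩⇒⇔→ (mk⇔ (λ f → ⊩-bot x ∘ f) (λ n → ⊥-elim ∘ n))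

    ⊩∧⇔× : ∀ {x A B} → x ⊩ (A ∧ B) ⇔ (x ⊩ A × x ⊩ B)
    ⊩∧⇔× = mk⇔
      (λ h → let n = λ f → to ⊩neg⇔¬ h (from ⊩⇒⇔→ (from ⊩neg⇔¬ ∘ f)) in
             dne (λ ¬a → n λ a → ⊥-elim (¬a a)) , dne (λ ¬b → n λ _ → ¬b))
      (λ (a , b) → from ⊩neg⇔¬ λ i → to ⊩neg⇔¬ (to ⊩⇒⇔→ i a) b)

    ⊩box⇔¬≺∁ : ∀ {x A} → x ⊩ box A ⇔ (¬ x ≺ ∁ ‖ A ‖)
    ⊩box⇔¬≺∁ {x} {A} = ⇔.trans (⊩-box x A) (meetsAll⇔¬≺∁ ‖ A ‖)

    ⊩box-neg⇔¬≺ : ∀ {x A} → x ⊩ box (neg A) ⇔ (¬ x ≺ ‖ A ‖)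
    ⊩box-neg⇔¬≺ = ⇔.trans ⊩box⇔¬≺∁ (mk⇔
      (contraposition λ c → ≺-mono c λ a na → to ⊩neg⇔¬ na a)
      (contraposition λ c → ≺-mono c λ n → dne (n ∘ from ⊩neg⇔¬)))

    ⊩¬□⊥⇔≺ : ∀ {x} → x ⊩ neg (box bot) ⇔ Σ (Subset W) (x ≺_)
    ⊩¬□⊥⇔≺ = mk⇔
      (λ h → ∁ ‖ bot ‖ , dne (to ⊩neg⇔¬ h ∘ from ⊩box⇔¬≺∁))
      (λ (V , xV) → from ⊩neg⇔¬ λ b → to ⊩box⇔¬≺∁ b (≺-mono xV λ _ → ⊩-bot _))

    ⊩¬[□∧□¬]⇔≺⊎≺∁ : ∀ {x A} → x ⊩ neg (box A ∧ box (neg A)) ⇔ (x ≺ ‖ A ‖ ⊎ x ≺ ∁ ‖ A ‖)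
    ⊩¬[□∧□¬]⇔≺⊎≺∁ = mk⇔
      (λ h → to ¬[¬×¬]⇔⊎ λ (n , n∁) →
        to ⊩neg⇔¬ h (from ⊩∧⇔× (from ⊩box⇔¬≺∁ n∁ , from ⊩box-neg⇔¬≺ n)))
      (λ d → from ⊩neg⇔¬ λ c → let (b , b¬) = to ⊩∧⇔× c in
        [ to ⊩box-neg⇔¬≺ b¬ , to ⊩box⇔¬≺∁ b ]′ d)

    ⊩□⇒□□ : Transitive F → ∀ {x A} → x ⊩ (box A ⇒ box (box A))
    ⊩□⇒□□ tr = from ⊩⇒⇔→ λ b → from ⊩box⇔¬≺∁ λ c →
      to ⊩box⇔¬≺∁ b (transitive-const tr c λ ¬bb → dne (¬bb ∘ from ⊩box⇔¬≺∁))

-- Satisfaction of □A quantifies over subsets of W, so it lives in Set₁; excluded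
-- middle at that level decides it and so brings it back down to Set.
module Models (em₁ : ExcludedMiddle (Level.suc 0ℓ)) (F : MNFrame) where
  open MNFrame F

  sat : (ℕ → Subset W) → W → Fm → Set
  sat v x (var n) = v n x
  sat v x bot     = ⊥
  sat v x (A ⇒ B) = ¬ sat v x A ⊎ sat v x B
  sat v x (box A) = True (em₁ {∀ V → x ≺ V → V ≬ λ y → sat v y A})

  valuationSatRel : (ℕ → Subset W) → SatRel F
  valuationSatRel v = record
    { _⊩_   = sat v
    ; ⊩-bot = λ _ ()
    ; ⊩-imp = λ _ _ _ → ⇔.refl
    ; ⊩-box = λ _ _ → mk⇔ toWitness fromWitness
    }

module Correspondence (em₀ : ExcludedMiddle 0ℓ) (em₁ : ExcludedMiddle (Level.suc 0ℓ))
                      (F : MNFrame) where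
  open MNFrame F
  open Classical em₀
  open Neighbourhoods em₀ F
  open Models em₁ F

  axiom4-valid⇔transitive : ∀ p → Valid F (box (var p) ⇒ box (box (var p))) ⇔ Transitive F
  axiom4-valid⇔transitive p = mk⇔ transitive λ tr S x → Truth.⊩□⇒□□ S tr
    where
    transitive : Valid F (box (var p) ⇒ box (box (var p))) → Transitive F
    transitive valid x V xV h =
      dne λ ¬x⋃ → to (⊩box⇔¬≺∁ {A = box (var p)}) (□p⇒□□p (□p ¬x⋃)) (≺-mono xV ¬□p)
      where
      ⋃ : Subset W
      ⋃ z = Σ W λ y → Σ (V y) λ v → proj₁ (h y v) z

      S : SatRel F
      S = valuationSatRel (λ _ → ∁ ⋃)
      open Truth S

      □p⇒□□p : x ⊩ box (var p) → x ⊩ box (box (var p))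
      □p⇒□□p = to (⊩⇒⇔→ {A = box (var p)} {B = box (box (var p))}) (valid S x)

      □p : ¬ x ≺ ⋃ → x ⊩ box (var p)
      □p = from (⊩box⇔¬≺∁ {A = var p}) ∘ contraposition ≺-∁∁

      ¬□p : ∀ {y} → V y → ¬ y ⊩ box (var p)
      ¬□p {y} v b =
        to (⊩box⇔¬≺∁ {A = var p}) b (≺-mono (proj₂ (h y v)) λ u ¬u → ¬u (y , v , u))

  axiomP-valid⇔MNP : Valid F (neg (box bot)) ⇔ IsMNP F
  axiomP-valid⇔MNP = mk⇔
    (λ valid x → let S = valuationSatRel (λ _ _ → ⊥) in to (⊩¬□⊥⇔≺ S) (valid S x))
    (λ mnp S x → from (⊩¬□⊥⇔≺ S) (mnp x))
    where open Truth

  axiomD-valid⇔MND : ∀ p → Valid F (neg (box (var p) ∧ box (neg (var p)))) ⇔ IsMND F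
  axiomD-valid⇔MND p = mk⇔
    (λ valid x V → let S = valuationSatRel (λ _ → V) in
                   to (⊩¬[□∧□¬]⇔≺⊎≺∁ S {A = var p}) (valid S x))
    (λ mnd S x → from (⊩¬[□∧□¬]⇔≺⊎≺∁ S) (mnd x (‖_‖ S (var p))))
    where open Truth

proposition3p4 : ExcludedMiddle 0ℓ → ExcludedMiddle (Level.suc 0ℓ) →
    (F : MNFrame) (p : ℕ) →
      (Valid F (box (var p) ⇒ box (box (var p))) ⇔ Transitive F)
    × (Valid F (neg (box bot)) ⇔ IsMNP F)
    × (Valid F (neg (box (var p) ∧ box (neg (var p)))) ⇔ IsMND F)
proposition3p4 em₀ em₁ F p =
  axiom4-valid⇔transitive p , axiomP-valid⇔MNP , axiomD-valid⇔MND p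
  where open Correspondence em₀ em₁ F
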